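{- Let $n\ge 1$ and let $D$ be a deck of $2n$ cards (distinct physical cards), each carrying a rank in $\{1,\dots,2n\}$, ranks possibly repeated. Let $\mathfrak{p}$ be a symmetric winning rule on $D$, and consider the game of $\mathfrak{p}$-war on $D$. Suppose that the initial hand $A(0)$ of player $A$ is uniformly distributed among all subsets of $D$ of a given size $A_0\in\{0,1,\dots,2n\}$. Then the process $(A_t)_{t\ge 0}$, where $A_t=|A(t)|$ is the number of cards held by player $A$ at time $t$, is a simple symmetric random walk on $\{0,1,\dots,2n\}$ started at $A_0$ and stopped upon hitting $0$ or $2n$.
   Context: A winning rule on the deck $D$ is a function $\mathfrak{p}$ assigning to every pair of distinct cards $a\neq b\in D$ and every subset $S\subseteq D\setminus\{a,b\}$ a number $p_{a,b}(S)\ge 0$ such that $p_{a,b}(S)+p_{b,a}(D\setminus(S\cup\{a,b\}))=1$. It is symmetric if $p_{a,b}(S)=p_{a,b}(D\setminus(S\cup\{a,b\}))$ for all such $a,b,S$ (equivalently $p_{a,b}(S)+p_{b,a}(S)=1$). The game of $\mathfrak{p}$-war is the Markov chain on states $(A,B)$ with $A\sqcup B=D$ (the hands of players $A$ and $B$); $(A(t),B(t))$ denotes the state at time $t$. The states $(\emptyset,D)$ and $(D,\emptyset)$ are absorbing. From a non-absorbing state, one draws independently a uniformly random card $a\in A(t)$, a uniformly random card $b\in B(t)$, and $U\sim\mathrm{Unif}([0,1])$; if $U\le p_{a,b}(A(t)\setminus\{a\})$ then $(A(t+1),B(t+1))=(A(t)\cup\{b\},B(t)\setminus\{b\})$, and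 otherwise $(A(t+1),B(t+1))=(A(t)\setminus\{a\},B(t)\cup\{a\})$.
   Formalization: The symmetric winning rule takes only rational values $p_{a,b}(S)$. -}

module Defs where

open import Data.Bool using (Bool; true; false; if_then_else_)
import Data.Bool as Bool
open import Data.Nat using (ℕ; zero; suc; _*_; _∸_; _≤_)
import Data.Nat as ℕ
open import Data.Nat.Combinatorics using (_C_)
open import Data.Integer using (+_)
open import Data.Rational using (ℚ; 0ℚ; 1ℚ; _+_; _-_; _/_)
import Data.Rational as ℚ
open import Data.Fin using (Fin)
open import Data.Fin.Subset using (Subset; inside; outside; _∈_; _∉_; ∁; _∪_; ⁅_⁆; ∣_∣) renaming (_-_ to _∖ₛ_)
open import Data.Fin.Subset.Properties using (_∈?_)
open import Data.Vec using (Vec; []; _∷_)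
open import Data.Vec.Properties using (≡-dec)
open import Data.List using (List; []; _∷_; map; foldr; _++_)
open import Data.List using (allFin) renaming (map to lmap)
open import Relation.Binary.PropositionalEquality using (_≡_; _≢_)
open import Relation.Nullary using (Dec; yes; no; does)

[_] : ∀ {ℓ} {P : Set ℓ} → Dec P → ℚ
[ d ] = if does d then 1ℚ else 0ℚ

Σℚ : List ℚ → ℚ
Σℚ = foldr _+_ 0ℚ

-- 1/k as a rational (the value at k = 0 is an irrelevant convention)
inv : ℕ → ℚ
inv zero    = 0ℚ
inv (suc k) = + 1 / suc k

_≟ₛ_ : ∀ {m} (S T : Subset m) → Dec (S ≡ T)
_≟ₛ_ = ≡-dec Bool._≟_

allSubsets : (m : ℕ) → List (Subset m)
allSubsets zero    = [] ∷ []
allSubsets (suc m) = lmap (inside ∷_) (allSubsets m) ++ lmap (outside ∷_) (allSubsets m)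

ΣS : ∀ {m} → (Subset m → ℚ) → ℚ
ΣS {m} f = Σℚ (lmap f (allSubsets m))

ΣF : ∀ {m} → (Fin m → ℚ) → ℚ
ΣF {m} f = Σℚ (lmap f (allFin m))

-- p a b S is p_{a,b}(S); only its values for a ≠ b and S ⊆ D ∖ {a,b}
-- are constrained (and used).
record WinningRule (m : ℕ) : Set where
  field
    p      : Fin m → Fin m → Subset m → ℚ
    nonneg : ∀ a b S → a ≢ b → a ∉ S → b ∉ S → 0ℚ ℚ.≤ p a b S
    compl  : ∀ a b S → a ≢ b → a ∉ S → b ∉ S →
             p a b S + p b a (∁ (S ∪ ⁅ a ⁆ ∪ ⁅ b ⁆)) ≡ 1ℚ

Symmetric : ∀ {m} → WinningRule m → Set
Symmetric {m} 𝔭 = ∀ a b S → a ≢ b → a ∉ S → b ∉ S →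
                  p a b S ≡ p a b (∁ (S ∪ ⁅ a ⁆ ∪ ⁅ b ⁆))
  where open WinningRule 𝔭

-- The p-war Markov chain; a state is player A's hand A ⊆ D (B = D ∖ A)

transition : ∀ {m} → WinningRule m → Subset m → Subset m → ℚ
transition {m} 𝔭 S S' with ∣ S ∣ ℕ.≟ 0 | ∣ S ∣ ℕ.≟ m
... | yes _ | _     = [ S' ≟ₛ S ]
... | no _  | yes _ = [ S' ≟ₛ S ]
... | no _  | no _  =
  ΣF λ a → [ a ∈? S ] ℚ.* ΣF λ b → [ b ∈? ∁ S ] ℚ.*
    (inv (∣ S ∣ * (m ∸ ∣ S ∣)) ℚ.*
      ( [ S' ≟ₛ (S ∪ ⁅ b ⁆) ] ℚ.* p a b (S ∖ₛ a)
      + [ S' ≟ₛ (S ∖ₛ a) ]     ℚ.* (1ℚ - p a b (S ∖ₛ a))))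
  where open WinningRule 𝔭

initialLaw : ∀ {m} → ℕ → Subset m → ℚ
initialLaw {m} A0 S = [ ∣ S ∣ ℕ.≟ A0 ] ℚ.* inv (m C A0)

-- given ν(S) = P(A(0..t) has sizes ... , A(t) = S), extend by the
-- further prescribed sizes xs
extend : ∀ {m} → WinningRule m → (Subset m → ℚ) → List ℕ → (Subset m → ℚ)
extend 𝔭 ν []       = ν
extend 𝔭 ν (x ∷ xs) =
  extend 𝔭 (λ S' → [ ∣ S' ∣ ℕ.≟ x ] ℚ.* ΣS (λ S → ν S ℚ.* transition 𝔭 S S')) xs

-- P(|A(0)| = x0, |A(1)| = x1, ..., |A(k)| = xk) for the p-war chain
-- started from the uniform law on subsets of size A0, where xs = x1 ∷ ... ∷ xk
warCountPathProb : ∀ {m} → WinningRule m → (A0 x0 : ℕ) → List ℕ → ℚ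
warCountPathProb 𝔭 A0 x0 xs =
  ΣS (extend 𝔭 (λ S → initialLaw A0 S ℚ.* [ ∣ S ∣ ℕ.≟ x0 ]) xs)

srwStep : ℕ → ℕ → ℕ → ℚ
srwStep m x y with x ℕ.≟ 0 | x ℕ.≟ m
... | yes _ | _     = [ y ℕ.≟ x ]
... | no _  | yes _ = [ y ℕ.≟ x ]
... | no _  | no _  = inv 2 ℚ.* ([ y ℕ.≟ suc x ] + [ suc y ℕ.≟ x ])

srwPath : ℕ → ℕ → List ℕ → ℚ
srwPath m x []       = 1ℚ
srwPath m x (y ∷ ys) = srwStep m x y ℚ.* srwPath m y ys

srwPathProb : (m A0 x0 : ℕ) → List ℕ → ℚ
srwPathProb m A0 x0 xs = [ x0 ℕ.≟ A0 ] ℚ.* srwPath m x0 xs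

{-# OPTIONS --safe #-}

-- For a symmetric rule p_{a,b}(T) + p_{b,a}(T) = 1.  When the one-step probabilities of
-- moving into a fixed hand S' are summed over all hands of size x, the ordered pairs of cards
-- (a , b) and (b , a) that can produce S' therefore contribute 1 together, so the total depends
-- on S' only through its size: with m = 2n cards it is C(m,x) / C(m,|S'|) times the probability
-- that the stopped simple random walk moves from x to |S'|.  Hence a measure which is uniform on
-- the hands of each size stays so after a step, with its weight on size x moving like the walk;
-- the initial law is such a measure.  Neither the ranks nor the assumption n ≥ 1 play any role.

module Submission where

open import Defs
open import Algebra.Bundles using (CommutativeRing)
open import Data.Empty using (⊥-elim)
open import Data.Fin using (Fin; zero; suc)
open import Data.Fin.Subset
  using (Subset; inside; outside; _∈_; _∉_; ∁; _∪_; ⁅_⁆; ∣_∣) renaming (_-_ to _∖ₛ_)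
open import Data.Fin.Subset.Properties
  using (_∈?_; ∪-comm; ∪-identityʳ; p─⊥≡p; x∈p∪q⁺; x∈⁅x⁆; p─q⊆p;
         x∈p∧x≢y⇒x∈p-y; x∈∁p⇒x∉p; x∉p⇒x∈∁p; ∣p∣≤n; ∣∁p∣≡n∸∣p∣; p─x─y≡p─y─x)
import Data.Integer as ℤ
import Data.Integer.Properties as ℤₚ
open import Data.List using (List; []; _∷_; _++_; allFin) renaming (map to lmap)
open import Data.List.Properties using (map-tabulate)
open import Data.Nat using (ℕ; zero; suc; pred; _*_; _∸_; _≤_; _<_; _≤?_)
import Data.Nat as ℕ
import Data.Nat.Properties as ℕₚ
open import Data.Nat.Combinatorics using (_C_; nCk+nC[k+1]≡[n+1]C[k+1]; nC1≡n; k>n⇒nCk≡0)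
open import Data.Nat.Coprimality using (1-coprimeTo) renaming (sym to coprime-sym)
import Data.Nat.Solver
open import Data.Product using (_×_; _,_)
open import Data.Rational using (ℚ; 0ℚ; 1ℚ; _+_; _-_; mkℚ) renaming (_*_ to _·_)
import Data.Rational.Properties as ℚ
import Data.Rational.Unnormalised as ℚᵘ
import Data.Rational.Unnormalised.Properties as ℚᵘ
open import Data.Rational.Solver using (module +-*-Solver)
open import Data.Sum using (_⊎_; inj₁; inj₂) renaming (map to ⊎-map)
open import Data.Vec using ([]; _∷_; here; there)
open import Function using (_∘_)
open import Relation.Binary.PropositionalEquality
  using (_≡_; _≢_; refl; sym; trans; cong; cong₂; subst; module ≡-Reasoning)
open import Relation.Nullary using (Dec; yes; no; ¬_)
open import Relation.Nullary.Decidable using (_×-dec_)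

open CommutativeRing ℚ.+-*-commutativeRing using (semiring)
open import Algebra.Properties.Semiring.Mult semiring
  using (×-homo-+; ×1-homo-*) renaming (_×_ to _×ℚ_)
open +-*-Solver
open ≡-Reasoning

[]-yes : ∀ {P : Set} (d : Dec P) → P → [ d ] ≡ 1ℚ
[]-yes (yes _) _ = refl
[]-yes (no ¬p) p = ⊥-elim (¬p p)

[]-no : ∀ {P : Set} (d : Dec P) → ¬ P → [ d ] ≡ 0ℚ
[]-no (yes p) ¬p = ⊥-elim (¬p p)
[]-no (no _)  _  = refl

[]-no-* : ∀ {P : Set} (d : Dec P) → ¬ P → (u : ℚ) → [ d ] · u ≡ 0ℚ
[]-no-* d ¬p u = trans (cong (_· u) ([]-no d ¬p)) (ℚ.*-zeroˡ u)

[]-cong : ∀ {P Q : Set} (d : Dec P) (e : Dec Q) → (P → Q) → (Q → P) → [ d ] ≡ [ e ]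
[]-cong d (yes q) _   Q→P = []-yes d (Q→P q)
[]-cong d (no ¬q) P→Q _   = []-no d (¬q ∘ P→Q)

[]-* : ∀ {P Q : Set} (d : Dec P) (e : Dec Q) → [ d ] · [ e ] ≡ [ d ×-dec e ]
[]-* (yes _) (yes _) = ℚ.*-identityˡ 1ℚ
[]-* (yes _) (no _)  = ℚ.*-zeroʳ 1ℚ
[]-* (no _)  e       = ℚ.*-zeroˡ [ e ]

[]-*-cong : ∀ {P : Set} (d : Dec P) {u v : ℚ} → (P → u ≡ v) → [ d ] · u ≡ [ d ] · v
[]-*-cong (yes p) u≡v = cong (1ℚ ·_) (u≡v p)
[]-*-cong (no ¬p) {u} {v} _ = trans ([]-no-* (no ¬p) ¬p u) (sym ([]-no-* (no ¬p) ¬p v))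

[]*[]-cong : ∀ {P Q R U : Set} (d : Dec P) (e : Dec Q) (f : Dec R) (g : Dec U) →
             (P × Q → R × U) → (R × U → P × Q) → [ d ] · [ e ] ≡ [ f ] · [ g ]
[]*[]-cong d e f g to from =
  trans ([]-* d e) (trans ([]-cong (d ×-dec e) (f ×-dec g) to from) (sym ([]-* f g)))

fromℕ : ℕ → ℚ
fromℕ n = n ×ℚ 1ℚ

fromℕ-+ : ∀ a b → fromℕ (a ℕ.+ b) ≡ fromℕ a + fromℕ b
fromℕ-+ = ×-homo-+ 1ℚ

fromℕ-* : ∀ a b → fromℕ (a * b) ≡ fromℕ a · fromℕ b
fromℕ-* = ×1-homo-*

integral : ℕ → ℚ
integral k = mkℚ (ℤ.+ k) 0 (coprime-sym (1-coprimeTo k))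

1+integral : ∀ k → 1ℚ + integral k ≡ integral (suc k)
1+integral k = ℚ.toℚᵘ-injective (ℚᵘ.≃-trans (ℚ.toℚᵘ-homo-+ 1ℚ (integral k))
  (ℚᵘ.*≡* (cong (λ z → (ℤ.+ 1 ℤ.+ z) ℤ.* ℤ.+ 1) (ℤₚ.*-identityʳ (ℤ.+ k)))))

fromℕ≡integral : ∀ k → fromℕ k ≡ integral k
fromℕ≡integral zero    = refl
fromℕ≡integral (suc k) = trans (cong (1ℚ +_) (fromℕ≡integral k)) (1+integral k)

inv*fromℕ : ∀ n → n ≢ 0 → inv n · fromℕ n ≡ 1ℚ
inv*fromℕ zero    n≢0 = ⊥-elim (n≢0 refl)
inv*fromℕ (suc k) _   = trans
  (cong₂ _·_ (ℚ.normalize-coprime (1-coprimeTo (suc k))) (fromℕ≡integral (suc k)))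
  (ℚ.*-inverseˡ (integral (suc k)))

half : ∀ {X Y} → X + X ≡ Y → X ≡ inv 2 · Y
half {X} {Y} X+X≡Y = begin
  X                        ≡⟨ sym (ℚ.*-identityˡ X) ⟩
  1ℚ · X                   ≡⟨ cong (_· X) (sym (inv*fromℕ 2 (λ ()))) ⟩
  (inv 2 · fromℕ 2) · X    ≡⟨ solve 2 (λ i x → (i :* (con 1ℚ :+ (con 1ℚ :+ con 0ℚ))) :* x := i :* (x :+ x))
                                      refl (inv 2) X ⟩
  inv 2 · (X + X)          ≡⟨ cong (inv 2 ·_) X+X≡Y ⟩
  inv 2 · Y                ∎

C[k+1]*[k+1]≡Ck*[n∸k] : ∀ n k → (n C suc k) * suc k ≡ (n C k) * (n ∸ k)
C[k+1]*[k+1]≡Ck*[n∸k] zero    k       =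
  sym (trans (cong ((zero C k) *_) (ℕₚ.0∸n≡0 k)) (ℕₚ.*-zeroʳ (zero C k)))
C[k+1]*[k+1]≡Ck*[n∸k] (suc n) zero    =
  trans (ℕₚ.*-identityʳ _) (trans (nC1≡n (suc n)) (sym (ℕₚ.+-identityʳ (suc n))))
C[k+1]*[k+1]≡Ck*[n∸k] (suc n) (suc k) with suc k ≤? n
... | no k+1≰n = trans (cong (_* suc (suc k)) (k>n⇒nCk≡0 (ℕ.s≤s (ℕₚ.≰⇒> k+1≰n))))
                       (sym (trans (cong ((suc n C suc k) *_) (ℕₚ.m≤n⇒m∸n≡0 (ℕₚ.≤-pred (ℕₚ.≰⇒> k+1≰n))))
                                   (ℕₚ.*-zeroʳ (suc n C suc k))))
... | yes k+1≤n = begin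
  (suc n C suc (suc k)) * suc (suc k)
    ≡⟨ cong (_* suc (suc k)) (sym (nCk+nC[k+1]≡[n+1]C[k+1] n (suc k))) ⟩
  ((n C suc k) ℕ.+ (n C suc (suc k))) * suc (suc k)
    ≡⟨ ℕₚ.*-distribʳ-+ (suc (suc k)) (n C suc k) _ ⟩
  (n C suc k) * suc (suc k) ℕ.+ (n C suc (suc k)) * suc (suc k)
    ≡⟨ cong ((n C suc k) * suc (suc k) ℕ.+_) (C[k+1]*[k+1]≡Ck*[n∸k] n (suc k)) ⟩
  (n C suc k) * suc (suc k) ℕ.+ (n C suc k) * (n ∸ suc k)
    ≡⟨ NS.solve 3 (λ c k d → c NS.:* (NS.con 2 NS.:+ k) NS.:+ c NS.:* d
                           NS.:= c NS.:* (NS.con 1 NS.:+ k) NS.:+ c NS.:* (NS.con 1 NS.:+ d))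
                  refl (n C suc k) k (n ∸ suc k) ⟩
  (n C suc k) * suc k ℕ.+ (n C suc k) * suc (n ∸ suc k)
    ≡⟨ cong₂ ℕ._+_ (C[k+1]*[k+1]≡Ck*[n∸k] n k) (cong ((n C suc k) *_) (sym (ℕₚ.+-∸-assoc 1 k+1≤n))) ⟩
  (n C k) * (n ∸ k) ℕ.+ (n C suc k) * (n ∸ k)
    ≡⟨ sym (ℕₚ.*-distribʳ-+ (n ∸ k) (n C k) _) ⟩
  ((n C k) ℕ.+ (n C suc k)) * (n ∸ k)
    ≡⟨ cong (_* (n ∸ k)) (nCk+nC[k+1]≡[n+1]C[k+1] n k) ⟩
  (suc n C suc k) * (n ∸ k) ∎
  where module NS = Data.Nat.Solver.+-*-Solver

C≢0 : ∀ {n k} → k ≤ n → n C k ≢ 0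
C≢0 {k = zero}  _            ()
C≢0 {suc n} {suc k} (ℕ.s≤s k≤n) nCk≡0 =
  C≢0 k≤n (ℕₚ.m+n≡0⇒m≡0 (n C k) (trans (nCk+nC[k+1]≡[n+1]C[k+1] n k) nCk≡0))

Σ⟨_⟩ : {A : Set} → List A → (A → ℚ) → ℚ
Σ⟨ L ⟩ f = Σℚ (lmap f L)

module _ {A : Set} where

  Σ-cong : (L : List A) {f g : A → ℚ} → (∀ x → f x ≡ g x) → Σ⟨ L ⟩ f ≡ Σ⟨ L ⟩ g
  Σ-cong []      _   = refl
  Σ-cong (x ∷ L) f≗g = cong₂ _+_ (f≗g x) (Σ-cong L f≗g)

  Σ-zero : (L : List A) {f : A → ℚ} → (∀ x → f x ≡ 0ℚ) → Σ⟨ L ⟩ f ≡ 0ℚ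
  Σ-zero []      _    = refl
  Σ-zero (x ∷ L) f≗0 = trans (cong₂ _+_ (f≗0 x) (Σ-zero L f≗0)) (ℚ.+-identityˡ 0ℚ)

  Σ-+ : (L : List A) (f g : A → ℚ) → Σ⟨ L ⟩ (λ x → f x + g x) ≡ Σ⟨ L ⟩ f + Σ⟨ L ⟩ g
  Σ-+ []      f g = refl
  Σ-+ (x ∷ L) f g = trans (cong ((f x + g x) +_) (Σ-+ L f g))
    (solve 4 (λ a b c d → (a :+ b) :+ (c :+ d) := (a :+ c) :+ (b :+ d)) refl (f x) (g x) (Σ⟨ L ⟩ f) (Σ⟨ L ⟩ g))

  Σ-*ˡ : (L : List A) (c : ℚ) (f : A → ℚ) → Σ⟨ L ⟩ (λ x → c · f x) ≡ c · Σ⟨ L ⟩ f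
  Σ-*ˡ []      c f = sym (ℚ.*-zeroʳ c)
  Σ-*ˡ (x ∷ L) c f = trans (cong (c · f x +_) (Σ-*ˡ L c f)) (sym (ℚ.*-distribˡ-+ c (f x) _))

  Σ-*ʳ : (L : List A) (f : A → ℚ) (c : ℚ) → Σ⟨ L ⟩ (λ x → f x · c) ≡ Σ⟨ L ⟩ f · c
  Σ-*ʳ L f c = trans (Σ-cong L (λ x → ℚ.*-comm (f x) c)) (trans (Σ-*ˡ L c f) (ℚ.*-comm c _))

  Σ-++ : (L M : List A) (f : A → ℚ) → Σ⟨ L ++ M ⟩ f ≡ Σ⟨ L ⟩ f + Σ⟨ M ⟩ f
  Σ-++ []      M f = sym (ℚ.+-identityˡ _)
  Σ-++ (x ∷ L) M f = trans (cong (f x +_) (Σ-++ L M f)) (sym (ℚ.+-assoc (f x) _ _))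

  Σ-map : {B : Set} (L : List B) (g : B → A) (f : A → ℚ) → Σ⟨ lmap g L ⟩ f ≡ Σ⟨ L ⟩ (f ∘ g)
  Σ-map []      g f = refl
  Σ-map (x ∷ L) g f = cong (f (g x) +_) (Σ-map L g f)

Σ-swap : {A B : Set} (L : List A) (M : List B) (f : A → B → ℚ) →
         Σ⟨ L ⟩ (λ x → Σ⟨ M ⟩ (f x)) ≡ Σ⟨ M ⟩ (λ y → Σ⟨ L ⟩ (λ x → f x y))
Σ-swap []      M f = sym (Σ-zero M (λ _ → refl))
Σ-swap (x ∷ L) M f = trans (cong (Σ⟨ M ⟩ (f x) +_) (Σ-swap L M f))
                           (sym (Σ-+ M (f x) (λ y → Σ⟨ L ⟩ (λ x′ → f x′ y))))

ΣS-∷ : ∀ {m} (f : Subset (suc m) → ℚ) →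
       ΣS f ≡ ΣS (λ S → f (inside ∷ S)) + ΣS (λ S → f (outside ∷ S))
ΣS-∷ {m} f = trans (Σ-++ (lmap (inside ∷_) (allSubsets m)) _ f)
  (cong₂ _+_ (Σ-map (allSubsets m) (inside ∷_) f) (Σ-map (allSubsets m) (outside ∷_) f))

ΣF-suc : ∀ {m} (f : Fin (suc m) → ℚ) → ΣF f ≡ f zero + ΣF (f ∘ suc)
ΣF-suc {m} f = cong (f zero +_)
  (trans (cong (λ L → Σ⟨ L ⟩ f) (sym (map-tabulate (λ i → i) suc))) (Σ-map (allFin m) suc f))

-- [ s ∷ S ≟ₛ t ∷ T ] computes to [ S ≟ₛ T ] when s and t agree and to 0ℚ otherwise.
ΣS-δ : ∀ {m} (T : Subset m) (f : Subset m → ℚ) → ΣS (λ S → [ S ≟ₛ T ] · f S) ≡ f T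
ΣS-δ []            f = trans (ℚ.+-identityʳ _) (ℚ.*-identityˡ (f []))
ΣS-δ (inside ∷ T)  f = trans (ΣS-∷ (λ S → [ S ≟ₛ (inside ∷ T) ] · f S)) (trans
  (cong₂ _+_ (ΣS-δ T (f ∘ (inside ∷_))) (Σ-zero (allSubsets _) (λ S → ℚ.*-zeroˡ (f (outside ∷ S)))))
  (ℚ.+-identityʳ _))
ΣS-δ (outside ∷ T) f = trans (ΣS-∷ (λ S → [ S ≟ₛ (outside ∷ T) ] · f S)) (trans
  (cong₂ _+_ (Σ-zero (allSubsets _) (λ S → ℚ.*-zeroˡ (f (inside ∷ S)))) (ΣS-δ T (f ∘ (outside ∷_))))
  (ℚ.+-identityˡ _))

ΣF-[∈] : ∀ {m} (S : Subset m) → ΣF (λ b → [ b ∈? S ]) ≡ fromℕ ∣ S ∣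
ΣF-[∈] []            = refl
ΣF-[∈] (inside ∷ S)  =
  trans (ΣF-suc (λ b → [ b ∈? (inside ∷ S) ])) (cong (1ℚ +_) (ΣF-[∈] S))
ΣF-[∈] (outside ∷ S) =
  trans (ΣF-suc (λ b → [ b ∈? (outside ∷ S) ])) (trans (ℚ.+-identityˡ _) (ΣF-[∈] S))

-- [ ∣ inside ∷ S ∣ ℕ.≟ suc k ] computes to [ ∣ S ∣ ℕ.≟ k ], so Pascal's rule does the rest.
ΣS-[∣∣≟] : ∀ m k → ΣS {m} (λ S → [ ∣ S ∣ ℕ.≟ k ]) ≡ fromℕ (m C k)
ΣS-[∣∣≟] zero    zero    = refl
ΣS-[∣∣≟] zero    (suc k) = ℚ.+-identityʳ 0ℚ
ΣS-[∣∣≟] (suc m) zero    = trans (ΣS-∷ {m} (λ S → [ ∣ S ∣ ℕ.≟ 0 ]))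
  (trans (cong (_+ ΣS {m} (λ S → [ ∣ S ∣ ℕ.≟ 0 ])) (Σ-zero (allSubsets m) (λ _ → refl)))
         (trans (ℚ.+-identityˡ _) (ΣS-[∣∣≟] m 0)))
ΣS-[∣∣≟] (suc m) (suc k) = trans (ΣS-∷ {m} (λ S → [ ∣ S ∣ ℕ.≟ suc k ]))
  (trans (cong₂ _+_ (ΣS-[∣∣≟] m k) (ΣS-[∣∣≟] m (suc k)))
         (trans (sym (fromℕ-+ (m C k) _)) (cong fromℕ (nCk+nC[k+1]≡[n+1]C[k+1] m k))))

ΣF₂ : ∀ {m} → (Fin m → Fin m → ℚ) → ℚ
ΣF₂ F = ΣF λ a → ΣF λ b → F a b

module _ {m : ℕ} where

  ΣF₂-cong : {F G : Fin m → Fin m → ℚ} → (∀ a b → F a b ≡ G a b) → ΣF₂ F ≡ ΣF₂ G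
  ΣF₂-cong F≗G = Σ-cong (allFin m) (λ a → Σ-cong (allFin m) (F≗G a))

  ΣF₂-*ˡ : (c : ℚ) (F : Fin m → Fin m → ℚ) → ΣF₂ (λ a b → c · F a b) ≡ c · ΣF₂ F
  ΣF₂-*ˡ c F = trans (Σ-cong (allFin m) (λ a → Σ-*ˡ (allFin m) c (F a))) (Σ-*ˡ (allFin m) c _)

  ΣF₂-+ : (F G : Fin m → Fin m → ℚ) → ΣF₂ (λ a b → F a b + G a b) ≡ ΣF₂ F + ΣF₂ G
  ΣF₂-+ F G = trans (Σ-cong (allFin m) (λ a → Σ-+ (allFin m) (F a) (G a))) (Σ-+ (allFin m) _ _)

  ΣF₂-transpose : (F : Fin m → Fin m → ℚ) → ΣF₂ F ≡ ΣF₂ (λ a b → F b a)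
  ΣF₂-transpose F = Σ-swap (allFin m) (allFin m) F

  ΣF₂-symmetrise : (F : Fin m → Fin m → ℚ) → ΣF₂ F + ΣF₂ F ≡ ΣF₂ (λ a b → F a b + F b a)
  ΣF₂-symmetrise F = trans (cong (ΣF₂ F +_) (ΣF₂-transpose F)) (sym (ΣF₂-+ F (λ a b → F b a)))

  ΣS-ΣF₂ : (F : Subset m → Fin m → Fin m → ℚ) → ΣS (λ S → ΣF₂ (F S)) ≡ ΣF₂ (λ a b → ΣS (λ S → F S a b))
  ΣS-ΣF₂ F = trans (Σ-swap (allSubsets m) (allFin m) _)
                   (Σ-cong (allFin m) (λ a → Σ-swap (allSubsets m) (allFin m) (λ S → F S a)))

x∉p-x : ∀ {n} (p : Subset n) (x : Fin n) → x ∉ p ∖ₛ x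
x∉p-x (s ∷ p) zero    ()
x∉p-x (s ∷ p) (suc x) (there x∈p-x) = x∉p-x p x x∈p-x

x∈p-y⇒x≢y : ∀ {n} {p : Subset n} {x y : Fin n} → x ∈ p ∖ₛ y → x ≢ y
x∈p-y⇒x≢y {p = p} {x} x∈p-x refl = x∉p-x p x x∈p-x

x∉p⇒p∪⁅x⁆-x≡p : ∀ {n} {p : Subset n} {x : Fin n} → x ∉ p → (p ∪ ⁅ x ⁆) ∖ₛ x ≡ p
x∉p⇒p∪⁅x⁆-x≡p {p = inside  ∷ p} {x = zero}  x∉p = ⊥-elim (x∉p here)
x∉p⇒p∪⁅x⁆-x≡p {p = outside ∷ p} {x = zero}  _   = cong (outside ∷_) (trans (p─⊥≡p _) (∪-identityʳ p))
x∉p⇒p∪⁅x⁆-x≡p {p = inside  ∷ p} {x = suc x} x∉p = cong (inside ∷_) (x∉p⇒p∪⁅x⁆-x≡p (x∉p ∘ there))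
x∉p⇒p∪⁅x⁆-x≡p {p = outside ∷ p} {x = suc x} x∉p = cong (outside ∷_) (x∉p⇒p∪⁅x⁆-x≡p (x∉p ∘ there))

x∈p⇒p-x∪⁅x⁆≡p : ∀ {n} {p : Subset n} {x : Fin n} → x ∈ p → (p ∖ₛ x) ∪ ⁅ x ⁆ ≡ p
x∈p⇒p-x∪⁅x⁆≡p {p = inside  ∷ p} {x = zero}  _           = cong (inside ∷_) (trans (∪-identityʳ _) (p─⊥≡p p))
x∈p⇒p-x∪⁅x⁆≡p {p = inside  ∷ p} {x = suc x} (there x∈p) = cong (inside ∷_) (x∈p⇒p-x∪⁅x⁆≡p x∈p)
x∈p⇒p-x∪⁅x⁆≡p {p = outside ∷ p} {x = suc x} (there x∈p) = cong (outside ∷_) (x∈p⇒p-x∪⁅x⁆≡p x∈p)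

x∈p⇒∣p∣≡1+∣p-x∣ : ∀ {n} {p : Subset n} {x : Fin n} → x ∈ p → ∣ p ∣ ≡ suc ∣ p ∖ₛ x ∣
x∈p⇒∣p∣≡1+∣p-x∣ {p = inside  ∷ p} {x = zero}  _           = cong (suc ∘ ∣_∣) (sym (p─⊥≡p p))
x∈p⇒∣p∣≡1+∣p-x∣ {p = inside  ∷ p} {x = suc x} (there x∈p) = cong suc (x∈p⇒∣p∣≡1+∣p-x∣ x∈p)
x∈p⇒∣p∣≡1+∣p-x∣ {p = outside ∷ p} {x = suc x} (there x∈p) = x∈p⇒∣p∣≡1+∣p-x∣ x∈p

x∉p⇒∣p∪⁅x⁆∣≡1+∣p∣ : ∀ {n} {p : Subset n} {x : Fin n} → x ∉ p → ∣ p ∪ ⁅ x ⁆ ∣ ≡ suc ∣ p ∣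
x∉p⇒∣p∪⁅x⁆∣≡1+∣p∣ {p = inside  ∷ p} {x = zero}  x∉p = ⊥-elim (x∉p here)
x∉p⇒∣p∪⁅x⁆∣≡1+∣p∣ {p = outside ∷ p} {x = zero}  _   = cong (suc ∘ ∣_∣) (∪-identityʳ p)
x∉p⇒∣p∪⁅x⁆∣≡1+∣p∣ {p = inside  ∷ p} {x = suc x} x∉p = cong suc (x∉p⇒∣p∪⁅x⁆∣≡1+∣p∣ (x∉p ∘ there))
x∉p⇒∣p∪⁅x⁆∣≡1+∣p∣ {p = outside ∷ p} {x = suc x} x∉p = x∉p⇒∣p∪⁅x⁆∣≡1+∣p∣ (x∉p ∘ there)

∁[p∪⁅x⁆]≡∁p-x : ∀ {n} (p : Subset n) (x : Fin n) → ∁ (p ∪ ⁅ x ⁆) ≡ ∁ p ∖ₛ x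
∁[p∪⁅x⁆]≡∁p-x (inside  ∷ p) zero    = cong (outside ∷_) (trans (cong ∁ (∪-identityʳ p)) (sym (p─⊥≡p (∁ p))))
∁[p∪⁅x⁆]≡∁p-x (outside ∷ p) zero    = cong (outside ∷_) (trans (cong ∁ (∪-identityʳ p)) (sym (p─⊥≡p (∁ p))))
∁[p∪⁅x⁆]≡∁p-x (inside  ∷ p) (suc x) = cong (outside ∷_) (∁[p∪⁅x⁆]≡∁p-x p x)
∁[p∪⁅x⁆]≡∁p-x (outside ∷ p) (suc x) = cong (inside ∷_) (∁[p∪⁅x⁆]≡∁p-x p x)

x∉p∧q≡p∪⁅x⁆⇒x∈q∧p≡q-x : ∀ {n} {p q : Subset n} {x : Fin n} → x ∉ p × q ≡ p ∪ ⁅ x ⁆ → x ∈ q × p ≡ q ∖ₛ x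
x∉p∧q≡p∪⁅x⁆⇒x∈q∧p≡q-x {p} {x = x} (x∉p , refl) = x∈p∪q⁺ (inj₂ (x∈⁅x⁆ x)) , sym (x∉p⇒p∪⁅x⁆-x≡p x∉p)

x∈q∧p≡q-x⇒x∉p∧q≡p∪⁅x⁆ : ∀ {n} {p q : Subset n} {x : Fin n} → x ∈ q × p ≡ q ∖ₛ x → x ∉ p × q ≡ p ∪ ⁅ x ⁆
x∈q∧p≡q-x⇒x∉p∧q≡p∪⁅x⁆ {q = q} {x} (x∈q , refl) = x∉p-x q x , sym (x∈p⇒p-x∪⁅x⁆≡p x∈q)

distinctPair : ∀ {m} → Subset m → Fin m → Fin m → ℚ
distinctPair T a b = [ a ∈? T ] · [ b ∈? T ∖ₛ a ]

pairSum : ∀ {m} → Subset m → (Fin m → Fin m → ℚ) → ℚ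
pairSum T q = ΣF₂ (λ a b → distinctPair T a b · q a b)

distinctPair-comm : ∀ {m} (T : Subset m) a b → distinctPair T a b ≡ distinctPair T b a
distinctPair-comm T a b = []*[]-cong (a ∈? T) (b ∈? T ∖ₛ a) (b ∈? T) (a ∈? T ∖ₛ b) flip flip
  where
  flip : ∀ {a b} → a ∈ T × b ∈ T ∖ₛ a → b ∈ T × a ∈ T ∖ₛ b
  flip {a} (a∈T , b∈T-a) = p─q⊆p T ⁅ a ⁆ b∈T-a , x∈p∧x≢y⇒x∈p-y a∈T (x∈p-y⇒x≢y b∈T-a ∘ sym)

ΣF₂-distinctPair : ∀ {m} (T : Subset m) → ΣF₂ (distinctPair T) ≡ fromℕ (∣ T ∣ * pred ∣ T ∣)
ΣF₂-distinctPair {m} T = begin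
  ΣF₂ (distinctPair T)
    ≡⟨ Σ-cong (allFin m) (λ a → Σ-*ˡ (allFin m) [ a ∈? T ] (λ b → [ b ∈? T ∖ₛ a ])) ⟩
  ΣF (λ a → [ a ∈? T ] · ΣF (λ b → [ b ∈? T ∖ₛ a ]))
    ≡⟨ Σ-cong (allFin m) (λ a → []-*-cong (a ∈? T) λ a∈T →
         trans (ΣF-[∈] (T ∖ₛ a)) (cong (fromℕ ∘ pred) (sym (x∈p⇒∣p∣≡1+∣p-x∣ a∈T)))) ⟩
  ΣF (λ a → [ a ∈? T ] · fromℕ (pred ∣ T ∣))
    ≡⟨ Σ-*ʳ (allFin m) (λ a → [ a ∈? T ]) _ ⟩
  ΣF (λ a → [ a ∈? T ]) · fromℕ (pred ∣ T ∣)
    ≡⟨ cong (_· fromℕ (pred ∣ T ∣)) (ΣF-[∈] T) ⟩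
  fromℕ ∣ T ∣ · fromℕ (pred ∣ T ∣)
    ≡⟨ sym (fromℕ-* ∣ T ∣ _) ⟩
  fromℕ (∣ T ∣ * pred ∣ T ∣) ∎

pairSum-doubled : ∀ {m} (T : Subset m) (q : Fin m → Fin m → ℚ) →
                  (∀ {a b} → a ∈ T → b ∈ T ∖ₛ a → q a b + q b a ≡ 1ℚ) →
                  pairSum T q + pairSum T q ≡ fromℕ (∣ T ∣ * pred ∣ T ∣)
pairSum-doubled T q q+qᵀ≡1 = begin
  pairSum T q + pairSum T q
    ≡⟨ ΣF₂-symmetrise (λ a b → distinctPair T a b · q a b) ⟩
  ΣF₂ (λ a b → distinctPair T a b · q a b + distinctPair T b a · q b a)
    ≡⟨ ΣF₂-cong pair ⟩
  ΣF₂ (distinctPair T)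
    ≡⟨ ΣF₂-distinctPair T ⟩
  fromℕ (∣ T ∣ * pred ∣ T ∣) ∎
  where
  pair : ∀ a b → distinctPair T a b · q a b + distinctPair T b a · q b a ≡ distinctPair T a b
  pair a b = begin
    distinctPair T a b · q a b + distinctPair T b a · q b a
      ≡⟨ cong (λ z → distinctPair T a b · q a b + z · q b a) (distinctPair-comm T b a) ⟩
    distinctPair T a b · q a b + distinctPair T a b · q b a
      ≡⟨ sym (ℚ.*-distribˡ-+ (distinctPair T a b) _ _) ⟩
    distinctPair T a b · (q a b + q b a)
      ≡⟨ cong (_· (q a b + q b a)) ([]-* (a ∈? T) (b ∈? T ∖ₛ a)) ⟩
    [ a∈T×b∈T-a ] · (q a b + q b a)
      ≡⟨ []-*-cong a∈T×b∈T-a (λ (a∈T , b∈T-a) → q+qᵀ≡1 a∈T b∈T-a) ⟩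
    [ a∈T×b∈T-a ] · 1ℚ
      ≡⟨ ℚ.*-identityʳ _ ⟩
    [ a∈T×b∈T-a ]
      ≡⟨ sym ([]-* (a ∈? T) (b ∈? T ∖ₛ a)) ⟩
    distinctPair T a b ∎
    where
    a∈T×b∈T-a : Dec (a ∈ T × b ∈ T ∖ₛ a)
    a∈T×b∈T-a = (a ∈? T) ×-dec (b ∈? T ∖ₛ a)

module _ {m : ℕ} (𝔭 : WinningRule m) where
  open WinningRule 𝔭

  -- A plays a and B plays b: A either takes b (gain) or gives up a (loss), arriving at S'.
  gain loss : Subset m → Subset m → Fin m → Fin m → ℚ
  gain S S' a b = [ a ∈? S ] · ([ b ∈? ∁ S ] · ([ S' ≟ₛ (S ∪ ⁅ b ⁆) ] · p a b (S ∖ₛ a)))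
  loss S S' a b = [ a ∈? S ] · ([ b ∈? ∁ S ] · ([ S' ≟ₛ (S ∖ₛ a) ] · (1ℚ - p a b (S ∖ₛ a))))

  transition-absorbing : ∀ S S' → ∣ S ∣ ≡ 0 ⊎ ∣ S ∣ ≡ m → transition 𝔭 S S' ≡ [ S' ≟ₛ S ]
  transition-absorbing S S' absorbed with ∣ S ∣ ℕ.≟ 0 | ∣ S ∣ ℕ.≟ m | absorbed
  ... | yes _ | _     | _          = refl
  ... | no _  | yes _ | _          = refl
  ... | no ≢0 | no _  | inj₁ ≡0    = ⊥-elim (≢0 ≡0)
  ... | no _  | no ≢m | inj₂ ≡m    = ⊥-elim (≢m ≡m)

  transition-interior : ∀ S S' → ∣ S ∣ ≢ 0 → ∣ S ∣ ≢ m →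
    transition 𝔭 S S' ≡ inv (∣ S ∣ * (m ∸ ∣ S ∣)) · (ΣF₂ (gain S S') + ΣF₂ (loss S S'))
  transition-interior S S' ≢0 ≢m with ∣ S ∣ ℕ.≟ 0 | ∣ S ∣ ℕ.≟ m
  ... | yes ≡0 | _      = ⊥-elim (≢0 ≡0)
  ... | no _   | yes ≡m = ⊥-elim (≢m ≡m)
  ... | no _   | no _   = trans
    (Σ-cong (allFin m) λ a → trans (sym (Σ-*ˡ (allFin m) [ a ∈? S ] _)) (Σ-cong (allFin m) (distribute a)))
    (trans (ΣF₂-*ˡ I (λ a b → gain S S' a b + loss S S' a b)) (cong (I ·_) (ΣF₂-+ (gain S S') (loss S S'))))
    where
    I : ℚ
    I = inv (∣ S ∣ * (m ∸ ∣ S ∣))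
    distribute : ∀ a b →
      [ a ∈? S ] · ([ b ∈? ∁ S ] · (I · ([ S' ≟ₛ (S ∪ ⁅ b ⁆) ] · p a b (S ∖ₛ a)
                                      + [ S' ≟ₛ (S ∖ₛ a) ] · (1ℚ - p a b (S ∖ₛ a)))))
        ≡ I · (gain S S' a b + loss S S' a b)
    distribute a b =
      solve 5 (λ A B i G L → A :* (B :* (i :* (G :+ L))) := i :* (A :* (B :* G) :+ A :* (B :* L))) refl
        [ a ∈? S ] [ b ∈? ∁ S ] I ([ S' ≟ₛ (S ∪ ⁅ b ⁆) ] · p a b (S ∖ₛ a)) ([ S' ≟ₛ (S ∖ₛ a) ] · (1ℚ - p a b (S ∖ₛ a)))

  inflow : ℕ → Subset m → ℚ
  inflow x S' = ΣS (λ S → [ ∣ S ∣ ℕ.≟ x ] · transition 𝔭 S S')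

  ΣS-uniform·transition : ∀ {x c} (ν : Subset m → ℚ) → (∀ S → ν S ≡ [ ∣ S ∣ ℕ.≟ x ] · c) → ∀ S' →
                          ΣS (λ S → ν S · transition 𝔭 S S') ≡ c · inflow x S'
  ΣS-uniform·transition {x} {c} ν ν-uniform S' = trans
    (Σ-cong (allSubsets m) λ S → trans (cong (_· transition 𝔭 S S') (ν-uniform S))
      (solve 3 (λ e c t → (e :* c) :* t := c :* (e :* t)) refl [ ∣ S ∣ ℕ.≟ x ] c (transition 𝔭 S S')))
    (Σ-*ˡ (allSubsets m) c _)

  inflow-absorbing : ∀ {x} S' → x ≡ 0 ⊎ x ≡ m → inflow x S' ≡ [ ∣ S' ∣ ℕ.≟ x ]
  inflow-absorbing {x} S' x-absorbing =
    trans (Σ-cong (allSubsets m) stay) (ΣS-δ S' (λ S → [ ∣ S ∣ ℕ.≟ x ]))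
    where
    stay : ∀ S → [ ∣ S ∣ ℕ.≟ x ] · transition 𝔭 S S' ≡ [ S ≟ₛ S' ] · [ ∣ S ∣ ℕ.≟ x ]
    stay S = trans
      ([]-*-cong (∣ S ∣ ℕ.≟ x) λ ∣S∣≡x →
        transition-absorbing S S' (⊎-map (trans ∣S∣≡x) (trans ∣S∣≡x) x-absorbing))
      (trans (ℚ.*-comm [ ∣ S ∣ ℕ.≟ x ] [ S' ≟ₛ S ])
             (cong (_· [ ∣ S ∣ ℕ.≟ x ]) ([]-cong (S' ≟ₛ S) (S ≟ₛ S') sym sym)))

  inflow-beyond : ∀ {x} S' → m < x → inflow x S' ≡ 0ℚ
  inflow-beyond {x} S' m<x = Σ-zero (allSubsets m) λ S →
    []-no-* (∣ S ∣ ℕ.≟ x) (λ ∣S∣≡x → ℕₚ.<⇒≱ m<x (subst (_≤ m) ∣S∣≡x (∣p∣≤n S))) _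

  gain-collapse : ∀ x S' a b → ΣS (λ S → [ ∣ S ∣ ℕ.≟ x ] · gain S S' a b)
                               ≡ [ ∣ S' ∣ ℕ.≟ suc x ] · (distinctPair S' b a · p a b ((S' ∖ₛ b) ∖ₛ a))
  gain-collapse x S' a b = begin
    ΣS (λ S → [ ∣ S ∣ ℕ.≟ x ] · gain S S' a b)
      ≡⟨ Σ-cong (allSubsets m) regroup ⟩
    ΣS (λ S → [ S ≟ₛ (S' ∖ₛ b) ] · ([ b ∈? S' ] · R S))
      ≡⟨ ΣS-δ (S' ∖ₛ b) (λ S → [ b ∈? S' ] · R S) ⟩
    [ b ∈? S' ] · R (S' ∖ₛ b)
      ≡⟨ []-*-cong (b ∈? S') (λ b∈S' →
           cong (λ k → [ k ℕ.≟ suc x ] · ([ a ∈? S' ∖ₛ b ] · P (S' ∖ₛ b))) (sym (x∈p⇒∣p∣≡1+∣p-x∣ b∈S'))) ⟩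
    [ b ∈? S' ] · ([ ∣ S' ∣ ℕ.≟ suc x ] · ([ a ∈? S' ∖ₛ b ] · P (S' ∖ₛ b)))
      ≡⟨ solve 4 (λ B c A q → B :* (c :* (A :* q)) := c :* ((B :* A) :* q)) refl
           [ b ∈? S' ] [ ∣ S' ∣ ℕ.≟ suc x ] [ a ∈? S' ∖ₛ b ] (P (S' ∖ₛ b)) ⟩
    [ ∣ S' ∣ ℕ.≟ suc x ] · (distinctPair S' b a · p a b ((S' ∖ₛ b) ∖ₛ a)) ∎
    where
    P R : Subset m → ℚ
    P S = p a b (S ∖ₛ a)
    R S = [ ∣ S ∣ ℕ.≟ x ] · ([ a ∈? S ] · P S)
    regroup : ∀ S → [ ∣ S ∣ ℕ.≟ x ] · gain S S' a b ≡ [ S ≟ₛ (S' ∖ₛ b) ] · ([ b ∈? S' ] · R S)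
    regroup S = begin
      [ ∣ S ∣ ℕ.≟ x ] · gain S S' a b
        ≡⟨ solve 5 (λ c A B E q → c :* (A :* (B :* (E :* q))) := (B :* E) :* (c :* (A :* q))) refl
             [ ∣ S ∣ ℕ.≟ x ] [ a ∈? S ] [ b ∈? ∁ S ] [ S' ≟ₛ (S ∪ ⁅ b ⁆) ] (P S) ⟩
      ([ b ∈? ∁ S ] · [ S' ≟ₛ (S ∪ ⁅ b ⁆) ]) · R S
        ≡⟨ cong (_· R S) ([]*[]-cong (b ∈? ∁ S) (S' ≟ₛ (S ∪ ⁅ b ⁆)) (S ≟ₛ (S' ∖ₛ b)) (b ∈? S')
             (λ (b∈∁S , S'≡S∪b) → let (b∈S' , S≡S'-b) = x∉p∧q≡p∪⁅x⁆⇒x∈q∧p≡q-x (x∈∁p⇒x∉p b∈∁S , S'≡S∪b)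
                                   in S≡S'-b , b∈S')
             (λ (S≡S'-b , b∈S') → let (b∉S , S'≡S∪b) = x∈q∧p≡q-x⇒x∉p∧q≡p∪⁅x⁆ (b∈S' , S≡S'-b)
                                   in x∉p⇒x∈∁p b∉S , S'≡S∪b)) ⟩
      ([ S ≟ₛ (S' ∖ₛ b) ] · [ b ∈? S' ]) · R S
        ≡⟨ ℚ.*-assoc [ S ≟ₛ (S' ∖ₛ b) ] [ b ∈? S' ] (R S) ⟩
      [ S ≟ₛ (S' ∖ₛ b) ] · ([ b ∈? S' ] · R S) ∎

  loss-collapse : ∀ x S' a b → ΣS (λ S → [ ∣ S ∣ ℕ.≟ x ] · loss S S' a b)
                               ≡ [ suc ∣ S' ∣ ℕ.≟ x ] · (distinctPair (∁ S') a b · (1ℚ - p a b S'))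
  loss-collapse x S' a b = begin
    ΣS (λ S → [ ∣ S ∣ ℕ.≟ x ] · loss S S' a b)
      ≡⟨ Σ-cong (allSubsets m) regroup ⟩
    ΣS (λ S → [ S ≟ₛ (S' ∪ ⁅ a ⁆) ] · ([ a ∈? ∁ S' ] · R S))
      ≡⟨ ΣS-δ (S' ∪ ⁅ a ⁆) (λ S → [ a ∈? ∁ S' ] · R S) ⟩
    [ a ∈? ∁ S' ] · R (S' ∪ ⁅ a ⁆)
      ≡⟨ []-*-cong (a ∈? ∁ S') (λ a∈∁S' → let a∉S' = x∈∁p⇒x∉p a∈∁S' in
           trans (cong (λ k → [ k ℕ.≟ x ] · Q (S' ∪ ⁅ a ⁆)) (x∉p⇒∣p∪⁅x⁆∣≡1+∣p∣ a∉S'))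
                 (cong₂ (λ U V → [ suc ∣ S' ∣ ℕ.≟ x ] · ([ b ∈? U ] · (1ℚ - p a b V)))
                        (∁[p∪⁅x⁆]≡∁p-x S' a) (x∉p⇒p∪⁅x⁆-x≡p a∉S'))) ⟩
    [ a ∈? ∁ S' ] · ([ suc ∣ S' ∣ ℕ.≟ x ] · ([ b ∈? ∁ S' ∖ₛ a ] · (1ℚ - p a b S')))
      ≡⟨ solve 4 (λ A c B q → A :* (c :* (B :* q)) := c :* ((A :* B) :* q)) refl
           [ a ∈? ∁ S' ] [ suc ∣ S' ∣ ℕ.≟ x ] [ b ∈? ∁ S' ∖ₛ a ] (1ℚ - p a b S') ⟩
    [ suc ∣ S' ∣ ℕ.≟ x ] · (distinctPair (∁ S') a b · (1ℚ - p a b S')) ∎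
    where
    Q R : Subset m → ℚ
    Q S = [ b ∈? ∁ S ] · (1ℚ - p a b (S ∖ₛ a))
    R S = [ ∣ S ∣ ℕ.≟ x ] · Q S
    regroup : ∀ S → [ ∣ S ∣ ℕ.≟ x ] · loss S S' a b ≡ [ S ≟ₛ (S' ∪ ⁅ a ⁆) ] · ([ a ∈? ∁ S' ] · R S)
    regroup S = begin
      [ ∣ S ∣ ℕ.≟ x ] · loss S S' a b
        ≡⟨ solve 5 (λ c A B E q → c :* (A :* (B :* (E :* q))) := (A :* E) :* (c :* (B :* q))) refl
             [ ∣ S ∣ ℕ.≟ x ] [ a ∈? S ] [ b ∈? ∁ S ] [ S' ≟ₛ (S ∖ₛ a) ] (1ℚ - p a b (S ∖ₛ a)) ⟩
      ([ a ∈? S ] · [ S' ≟ₛ (S ∖ₛ a) ]) · R S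
        ≡⟨ cong (_· R S) ([]*[]-cong (a ∈? S) (S' ≟ₛ (S ∖ₛ a)) (S ≟ₛ (S' ∪ ⁅ a ⁆)) (a ∈? ∁ S')
             (λ (a∈S , S'≡S-a) → let (a∉S' , S≡S'∪a) = x∈q∧p≡q-x⇒x∉p∧q≡p∪⁅x⁆ (a∈S , S'≡S-a)
                                 in S≡S'∪a , x∉p⇒x∈∁p a∉S')
             (λ (S≡S'∪a , a∈∁S') → x∉p∧q≡p∪⁅x⁆⇒x∈q∧p≡q-x (x∈∁p⇒x∉p a∈∁S' , S≡S'∪a))) ⟩
      ([ S ≟ₛ (S' ∪ ⁅ a ⁆) ] · [ a ∈? ∁ S' ]) · R S
        ≡⟨ ℚ.*-assoc [ S ≟ₛ (S' ∪ ⁅ a ⁆) ] [ a ∈? ∁ S' ] (R S) ⟩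
      [ S ≟ₛ (S' ∪ ⁅ a ⁆) ] · ([ a ∈? ∁ S' ] · R S) ∎

  gainSum lossSum : Subset m → ℚ
  gainSum S' = pairSum S' (λ a b → p b a ((S' ∖ₛ a) ∖ₛ b))
  lossSum S' = pairSum (∁ S') (λ a b → 1ℚ - p a b S')

  inflow-by-pairs : ∀ {x} S' → x ≢ 0 → x ≢ m →
    inflow x S' ≡ inv (x * (m ∸ x)) · (ΣF₂ (λ a b → ΣS (λ S → [ ∣ S ∣ ℕ.≟ x ] · gain S S' a b))
                                       + ΣF₂ (λ a b → ΣS (λ S → [ ∣ S ∣ ℕ.≟ x ] · loss S S' a b)))
  inflow-by-pairs {x} S' x≢0 x≢m = begin
    inflow x S'
      ≡⟨ Σ-cong (allSubsets m) expand ⟩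
    ΣS (λ S → I · (ΣF₂ (G S) + ΣF₂ (L S)))
      ≡⟨ Σ-*ˡ (allSubsets m) I _ ⟩
    I · ΣS (λ S → ΣF₂ (G S) + ΣF₂ (L S))
      ≡⟨ cong (I ·_) (trans (Σ-+ (allSubsets m) _ _) (cong₂ _+_ (ΣS-ΣF₂ G) (ΣS-ΣF₂ L))) ⟩
    I · (ΣF₂ (λ a b → ΣS (λ S → G S a b)) + ΣF₂ (λ a b → ΣS (λ S → L S a b))) ∎
    where
    I : ℚ
    I = inv (x * (m ∸ x))
    G L : Subset m → Fin m → Fin m → ℚ
    G S a b = [ ∣ S ∣ ℕ.≟ x ] · gain S S' a b
    L S a b = [ ∣ S ∣ ℕ.≟ x ] · loss S S' a b
    expand : ∀ S → [ ∣ S ∣ ℕ.≟ x ] · transition 𝔭 S S' ≡ I · (ΣF₂ (G S) + ΣF₂ (L S))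
    expand S = begin
      [ ∣ S ∣ ℕ.≟ x ] · transition 𝔭 S S'
        ≡⟨ []-*-cong (∣ S ∣ ℕ.≟ x) (λ ∣S∣≡x →
             trans (transition-interior S S' (x≢0 ∘ trans (sym ∣S∣≡x)) (x≢m ∘ trans (sym ∣S∣≡x)))
                   (cong (λ k → inv (k * (m ∸ k)) · (ΣF₂ (gain S S') + ΣF₂ (loss S S'))) ∣S∣≡x)) ⟩
      [ ∣ S ∣ ℕ.≟ x ] · (I · (ΣF₂ (gain S S') + ΣF₂ (loss S S')))
        ≡⟨ solve 4 (λ c i A B → c :* (i :* (A :+ B)) := i :* (c :* A :+ c :* B)) refl
             [ ∣ S ∣ ℕ.≟ x ] I (ΣF₂ (gain S S')) (ΣF₂ (loss S S')) ⟩
      I · ([ ∣ S ∣ ℕ.≟ x ] · ΣF₂ (gain S S') + [ ∣ S ∣ ℕ.≟ x ] · ΣF₂ (loss S S'))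
        ≡⟨ cong (I ·_) (sym (cong₂ _+_ (ΣF₂-*ˡ [ ∣ S ∣ ℕ.≟ x ] (gain S S'))
                                       (ΣF₂-*ˡ [ ∣ S ∣ ℕ.≟ x ] (loss S S')))) ⟩
      I · (ΣF₂ (G S) + ΣF₂ (L S)) ∎

  inflow-interior : ∀ {x} S' → x ≢ 0 → x ≢ m →
    inflow x S' ≡ inv (x * (m ∸ x)) · ([ ∣ S' ∣ ℕ.≟ suc x ] · gainSum S' + [ suc ∣ S' ∣ ℕ.≟ x ] · lossSum S')
  inflow-interior {x} S' x≢0 x≢m =
    trans (inflow-by-pairs S' x≢0 x≢m) (cong (inv (x * (m ∸ x)) ·_) (cong₂ _+_ gains losses))
    where
    gains : ΣF₂ (λ a b → ΣS (λ S → [ ∣ S ∣ ℕ.≟ x ] · gain S S' a b)) ≡ [ ∣ S' ∣ ℕ.≟ suc x ] · gainSum S'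
    gains = begin
      ΣF₂ (λ a b → ΣS (λ S → [ ∣ S ∣ ℕ.≟ x ] · gain S S' a b))
        ≡⟨ ΣF₂-cong (gain-collapse x S') ⟩
      ΣF₂ (λ a b → [ ∣ S' ∣ ℕ.≟ suc x ] · (distinctPair S' b a · p a b ((S' ∖ₛ b) ∖ₛ a)))
        ≡⟨ ΣF₂-*ˡ [ ∣ S' ∣ ℕ.≟ suc x ] (λ a b → distinctPair S' b a · p a b ((S' ∖ₛ b) ∖ₛ a)) ⟩
      [ ∣ S' ∣ ℕ.≟ suc x ] · ΣF₂ (λ a b → distinctPair S' b a · p a b ((S' ∖ₛ b) ∖ₛ a))
        ≡⟨ cong ([ ∣ S' ∣ ℕ.≟ suc x ] ·_) (ΣF₂-transpose (λ a b → distinctPair S' b a · p a b ((S' ∖ₛ b) ∖ₛ a))) ⟩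
      [ ∣ S' ∣ ℕ.≟ suc x ] · gainSum S' ∎
    losses : ΣF₂ (λ a b → ΣS (λ S → [ ∣ S ∣ ℕ.≟ x ] · loss S S' a b)) ≡ [ suc ∣ S' ∣ ℕ.≟ x ] · lossSum S'
    losses = trans (ΣF₂-cong (loss-collapse x S'))
                   (ΣF₂-*ˡ [ suc ∣ S' ∣ ℕ.≟ x ] (λ a b → distinctPair (∁ S') a b · (1ℚ - p a b S')))

c·X/K≡c′/2 : ∀ {X} c N c′ K → K ≢ 0 → X + X ≡ fromℕ N → c * N ≡ c′ * K →
             fromℕ c · (inv K · X) ≡ fromℕ c′ · inv 2
c·X/K≡c′/2 {X} c N c′ K K≢0 X+X≡N cN≡c′K = begin
  fromℕ c · (inv K · X)
    ≡⟨ cong (λ z → fromℕ c · (inv K · z)) (half X+X≡N) ⟩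
  fromℕ c · (inv K · (inv 2 · fromℕ N))
    ≡⟨ solve 4 (λ c k h n → c :* (k :* (h :* n)) := h :* (k :* (c :* n))) refl (fromℕ c) (inv K) (inv 2) (fromℕ N) ⟩
  inv 2 · (inv K · (fromℕ c · fromℕ N))
    ≡⟨ cong (λ z → inv 2 · (inv K · z)) (trans (sym (fromℕ-* c N)) (trans (cong fromℕ cN≡c′K) (fromℕ-* c′ K))) ⟩
  inv 2 · (inv K · (fromℕ c′ · fromℕ K))
    ≡⟨ solve 4 (λ h k c n → h :* (k :* (c :* n)) := (c :* h) :* (k :* n)) refl (inv 2) (inv K) (fromℕ c′) (fromℕ K) ⟩
  (fromℕ c′ · inv 2) · (inv K · fromℕ K)
    ≡⟨ trans (cong ((fromℕ c′ · inv 2) ·_) (inv*fromℕ K K≢0)) (ℚ.*-identityʳ _) ⟩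
  fromℕ c′ · inv 2 ∎

x*[m∸x]≢0 : ∀ {m x} → x ≢ 0 → x < m → x * (m ∸ x) ≢ 0
x*[m∸x]≢0 {m} {x} x≢0 x<m x[m∸x]≡0 with ℕₚ.m*n≡0⇒m≡0∨n≡0 x x[m∸x]≡0
... | inj₁ x≡0   = x≢0 x≡0
... | inj₂ m∸x≡0 = ℕₚ.<⇒≱ x<m (ℕₚ.m∸n≡0⇒m≤n m∸x≡0)

C[x+1]*[x+1]x≡Cx*x[m∸x] : ∀ m x → (m C suc x) * (suc x * x) ≡ (m C x) * (x * (m ∸ x))
C[x+1]*[x+1]x≡Cx*x[m∸x] m x = begin
  (m C suc x) * (suc x * x)     ≡⟨ sym (ℕₚ.*-assoc (m C suc x) (suc x) x) ⟩
  (m C suc x) * suc x * x       ≡⟨ cong (_* x) (C[k+1]*[k+1]≡Ck*[n∸k] m x) ⟩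
  (m C x) * (m ∸ x) * x         ≡⟨ ℕₚ.*-assoc (m C x) (m ∸ x) x ⟩
  (m C x) * ((m ∸ x) * x)       ≡⟨ cong ((m C x) *_) (ℕₚ.*-comm (m ∸ x) x) ⟩
  (m C x) * (x * (m ∸ x))       ∎

Cy*[m∸y][m∸y-1]≡C[y+1]*[y+1][m∸y-1] : ∀ m y →
  (m C y) * ((m ∸ y) * pred (m ∸ y)) ≡ (m C suc y) * (suc y * (m ∸ suc y))
Cy*[m∸y][m∸y-1]≡C[y+1]*[y+1][m∸y-1] m y = begin
  (m C y) * ((m ∸ y) * pred (m ∸ y))  ≡⟨ sym (ℕₚ.*-assoc (m C y) (m ∸ y) _) ⟩
  (m C y) * (m ∸ y) * pred (m ∸ y)    ≡⟨ cong₂ _*_ (sym (C[k+1]*[k+1]≡Ck*[n∸k] m y)) (ℕₚ.pred[m∸n]≡m∸[1+n] m y) ⟩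
  (m C suc y) * suc y * (m ∸ suc y)   ≡⟨ ℕₚ.*-assoc (m C suc y) (suc y) (m ∸ suc y) ⟩
  (m C suc y) * (suc y * (m ∸ suc y)) ∎

interior-balance : ∀ m x y {G L} → x ≢ 0 → x < m →
  G + G ≡ fromℕ (y * pred y) → L + L ≡ fromℕ ((m ∸ y) * pred (m ∸ y)) →
  fromℕ (m C y) · (inv (x * (m ∸ x)) · ([ y ℕ.≟ suc x ] · G + [ suc y ℕ.≟ x ] · L))
    ≡ fromℕ (m C x) · (inv 2 · ([ y ℕ.≟ suc x ] + [ suc y ℕ.≟ x ]))
interior-balance m x y {G} {L} x≢0 x<m G+G L+L with y ℕ.≟ suc x
... | yes refl = begin
  fromℕ (m C suc x) · (inv (x * (m ∸ x)) · ([ suc x ℕ.≟ suc x ] · G + [ suc (suc x) ℕ.≟ x ] · L))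
    ≡⟨ cong₂ (λ u v → fromℕ (m C suc x) · (inv (x * (m ∸ x)) · (u · G + v · L))) up down ⟩
  fromℕ (m C suc x) · (inv (x * (m ∸ x)) · (1ℚ · G + 0ℚ · L))
    ≡⟨ cong (λ z → fromℕ (m C suc x) · (inv (x * (m ∸ x)) · z))
            (solve 2 (λ g l → con 1ℚ :* g :+ con 0ℚ :* l := g) refl G L) ⟩
  fromℕ (m C suc x) · (inv (x * (m ∸ x)) · G)
    ≡⟨ c·X/K≡c′/2 (m C suc x) _ (m C x) _ (x*[m∸x]≢0 x≢0 x<m) G+G (C[x+1]*[x+1]x≡Cx*x[m∸x] m x) ⟩
  fromℕ (m C x) · inv 2
    ≡⟨ cong (fromℕ (m C x) ·_) (solve 1 (λ h → h := h :* (con 1ℚ :+ con 0ℚ)) refl (inv 2)) ⟩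
  fromℕ (m C x) · (inv 2 · (1ℚ + 0ℚ))
    ≡⟨ cong₂ (λ u v → fromℕ (m C x) · (inv 2 · (u + v))) (sym up) (sym down) ⟩
  fromℕ (m C x) · (inv 2 · ([ suc x ℕ.≟ suc x ] + [ suc (suc x) ℕ.≟ x ])) ∎
  where
  up : [ suc x ℕ.≟ suc x ] ≡ 1ℚ
  up = []-yes (suc x ℕ.≟ suc x) refl
  down : [ suc (suc x) ℕ.≟ x ] ≡ 0ℚ
  down = []-no (suc (suc x) ℕ.≟ x) (λ x+2≡x → ℕₚ.<-irrefl (sym x+2≡x) (ℕₚ.m<n⇒m<1+n (ℕₚ.n<1+n x)))
... | no y≢x+1 with suc y ℕ.≟ x
...   | yes refl = begin
  fromℕ (m C y) · (inv (suc y * (m ∸ suc y)) · ([ y ℕ.≟ suc (suc y) ] · G + [ suc y ℕ.≟ suc y ] · L))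
    ≡⟨ cong₂ (λ u v → fromℕ (m C y) · (inv (suc y * (m ∸ suc y)) · (u · G + v · L))) up down ⟩
  fromℕ (m C y) · (inv (suc y * (m ∸ suc y)) · (0ℚ · G + 1ℚ · L))
    ≡⟨ cong (λ z → fromℕ (m C y) · (inv (suc y * (m ∸ suc y)) · z))
            (solve 2 (λ g l → con 0ℚ :* g :+ con 1ℚ :* l := l) refl G L) ⟩
  fromℕ (m C y) · (inv (suc y * (m ∸ suc y)) · L)
    ≡⟨ c·X/K≡c′/2 (m C y) _ (m C suc y) _ (x*[m∸x]≢0 x≢0 x<m) L+L (Cy*[m∸y][m∸y-1]≡C[y+1]*[y+1][m∸y-1] m y) ⟩
  fromℕ (m C suc y) · inv 2
    ≡⟨ cong (fromℕ (m C suc y) ·_) (solve 1 (λ h → h := h :* (con 0ℚ :+ con 1ℚ)) refl (inv 2)) ⟩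
  fromℕ (m C suc y) · (inv 2 · (0ℚ + 1ℚ))
    ≡⟨ cong₂ (λ u v → fromℕ (m C suc y) · (inv 2 · (u + v))) (sym up) (sym down) ⟩
  fromℕ (m C suc y) · (inv 2 · ([ y ℕ.≟ suc (suc y) ] + [ suc y ℕ.≟ suc y ])) ∎
  where
  up : [ y ℕ.≟ suc (suc y) ] ≡ 0ℚ
  up = []-no (y ℕ.≟ suc (suc y)) y≢x+1
  down : [ suc y ℕ.≟ suc y ] ≡ 1ℚ
  down = []-yes (suc y ℕ.≟ suc y) refl
...   | no y+1≢x = begin
  fromℕ (m C y) · (inv (x * (m ∸ x)) · ([ y ℕ.≟ suc x ] · G + [ suc y ℕ.≟ x ] · L))
    ≡⟨ cong₂ (λ u v → fromℕ (m C y) · (inv (x * (m ∸ x)) · (u · G + v · L))) up down ⟩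
  fromℕ (m C y) · (inv (x * (m ∸ x)) · (0ℚ · G + 0ℚ · L))
    ≡⟨ solve 6 (λ c k g l c′ h → c :* (k :* (con 0ℚ :* g :+ con 0ℚ :* l)) := c′ :* (h :* (con 0ℚ :+ con 0ℚ))) refl
         (fromℕ (m C y)) (inv (x * (m ∸ x))) G L (fromℕ (m C x)) (inv 2) ⟩
  fromℕ (m C x) · (inv 2 · (0ℚ + 0ℚ))
    ≡⟨ cong₂ (λ u v → fromℕ (m C x) · (inv 2 · (u + v))) (sym up) (sym down) ⟩
  fromℕ (m C x) · (inv 2 · ([ y ℕ.≟ suc x ] + [ suc y ℕ.≟ x ])) ∎
  where
  up : [ y ℕ.≟ suc x ] ≡ 0ℚ
  up = []-no (y ℕ.≟ suc x) y≢x+1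
  down : [ suc y ℕ.≟ x ] ≡ 0ℚ
  down = []-no (suc y ℕ.≟ x) y+1≢x

srwStep-beyond : ∀ {m x y} → x ≤ m → m < y → srwStep m x y ≡ 0ℚ
srwStep-beyond {m} {x} {y} x≤m m<y with x ℕ.≟ 0 | x ℕ.≟ m
... | yes _ | _      = []-no (y ℕ.≟ x) (λ y≡x → ℕₚ.<⇒≱ m<y (subst (_≤ m) (sym y≡x) x≤m))
... | no _  | yes _  = []-no (y ℕ.≟ x) (λ y≡x → ℕₚ.<⇒≱ m<y (subst (_≤ m) (sym y≡x) x≤m))
... | no _  | no x≢m = trans (cong (inv 2 ·_) (trans
  (cong₂ _+_ ([]-no (y ℕ.≟ suc x) (λ y≡x+1 → ℕₚ.<⇒≱ m<y (subst (_≤ m) (sym y≡x+1) (ℕₚ.≤∧≢⇒< x≤m x≢m))))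
             ([]-no (suc y ℕ.≟ x) (λ y+1≡x → ℕₚ.<⇒≱ m<y (ℕₚ.<⇒≤ (subst (_≤ m) (sym y+1≡x) x≤m)))))
  (ℚ.+-identityʳ 0ℚ))) (ℚ.*-zeroʳ (inv 2))

[mCx]·u≡0 : ∀ {m x} u → m < x → fromℕ (m C x) · u ≡ 0ℚ
[mCx]·u≡0 {m} {x} u m<x = trans (cong (λ k → fromℕ k · u) (k>n⇒nCk≡0 m<x)) (ℚ.*-zeroˡ u)

C*srwStep-beyond : ∀ m x {y} → m < y → fromℕ (m C x) · srwStep m x y ≡ 0ℚ
C*srwStep-beyond m x {y} m<y with x ≤? m
... | yes x≤m = trans (cong (fromℕ (m C x) ·_) (srwStep-beyond x≤m m<y)) (ℚ.*-zeroʳ (fromℕ (m C x)))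
... | no x≰m  = [mCx]·u≡0 (srwStep m x y) (ℕₚ.≰⇒> x≰m)

-- Lumpability

module _ {m : ℕ} (𝔭 : WinningRule m) (𝔭-symmetric : Symmetric 𝔭) where
  open WinningRule 𝔭

  p+pᵀ≡1 : ∀ {a b T} → a ≢ b → a ∉ T → b ∉ T → p a b T + p b a T ≡ 1ℚ
  p+pᵀ≡1 {a} {b} {T} a≢b a∉T b∉T = begin
    p a b T + p b a T                         ≡⟨ ℚ.+-comm (p a b T) (p b a T) ⟩
    p b a T + p a b T                         ≡⟨ cong (p b a T +_) (𝔭-symmetric a b T a≢b a∉T b∉T) ⟩
    p b a T + p a b (∁ (T ∪ ⁅ a ⁆ ∪ ⁅ b ⁆))    ≡⟨ cong (λ U → p b a T + p a b (∁ (T ∪ U))) (∪-comm ⁅ a ⁆ ⁅ b ⁆) ⟩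
    p b a T + p a b (∁ (T ∪ ⁅ b ⁆ ∪ ⁅ a ⁆))    ≡⟨ compl b a T (a≢b ∘ sym) b∉T a∉T ⟩
    1ℚ                                        ∎

  gainSum-doubled : ∀ S' → gainSum 𝔭 S' + gainSum 𝔭 S' ≡ fromℕ (∣ S' ∣ * pred ∣ S' ∣)
  gainSum-doubled S' = pairSum-doubled S' _ λ {a} {b} a∈S' b∈S'-a → begin
    p b a ((S' ∖ₛ a) ∖ₛ b) + p a b ((S' ∖ₛ b) ∖ₛ a)
      ≡⟨ cong (λ T → p b a ((S' ∖ₛ a) ∖ₛ b) + p a b T) (p─x─y≡p─y─x S' b a) ⟩
    p b a ((S' ∖ₛ a) ∖ₛ b) + p a b ((S' ∖ₛ a) ∖ₛ b)
      ≡⟨ p+pᵀ≡1 (x∈p-y⇒x≢y b∈S'-a) (x∉p-x (S' ∖ₛ a) b) (x∉p-x S' a ∘ p─q⊆p (S' ∖ₛ a) ⁅ b ⁆) ⟩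
    1ℚ ∎

  lossSum-doubled : ∀ S' → lossSum 𝔭 S' + lossSum 𝔭 S' ≡ fromℕ ((m ∸ ∣ S' ∣) * pred (m ∸ ∣ S' ∣))
  lossSum-doubled S' = trans
    (pairSum-doubled (∁ S') _ λ {a} {b} a∈∁S' b∈∁S'-a → begin
      (1ℚ - p a b S') + (1ℚ - p b a S')
        ≡⟨ solve 2 (λ P Q → (con 1ℚ :- P) :+ (con 1ℚ :- Q) := con 1ℚ :+ con 1ℚ :- (P :+ Q)) refl (p a b S') (p b a S') ⟩
      1ℚ + 1ℚ - (p a b S' + p b a S')
        ≡⟨ cong (λ z → 1ℚ + 1ℚ - z)
                (p+pᵀ≡1 (x∈p-y⇒x≢y b∈∁S'-a ∘ sym) (x∈∁p⇒x∉p a∈∁S') (x∈∁p⇒x∉p (p─q⊆p (∁ S') ⁅ a ⁆ b∈∁S'-a))) ⟩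
      1ℚ + 1ℚ - 1ℚ
        ≡⟨ refl ⟩
      1ℚ ∎)
    (cong (λ k → fromℕ (k * pred k)) (∣∁p∣≡n∸∣p∣ S'))

  inflow-lumped-absorbing : ∀ {x} S' → x ≡ 0 ⊎ x ≡ m →
    fromℕ (m C ∣ S' ∣) · inflow 𝔭 x S' ≡ fromℕ (m C x) · [ ∣ S' ∣ ℕ.≟ x ]
  inflow-lumped-absorbing {x} S' x-absorbing = begin
    fromℕ (m C ∣ S' ∣) · inflow 𝔭 x S'         ≡⟨ cong (fromℕ (m C ∣ S' ∣) ·_) (inflow-absorbing 𝔭 S' x-absorbing) ⟩
    fromℕ (m C ∣ S' ∣) · [ ∣ S' ∣ ℕ.≟ x ]      ≡⟨ ℚ.*-comm (fromℕ (m C ∣ S' ∣)) _ ⟩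
    [ ∣ S' ∣ ℕ.≟ x ] · fromℕ (m C ∣ S' ∣)      ≡⟨ []-*-cong (∣ S' ∣ ℕ.≟ x) (cong (fromℕ ∘ (m C_))) ⟩
    [ ∣ S' ∣ ℕ.≟ x ] · fromℕ (m C x)           ≡⟨ ℚ.*-comm [ ∣ S' ∣ ℕ.≟ x ] _ ⟩
    fromℕ (m C x) · [ ∣ S' ∣ ℕ.≟ x ]           ∎

  inflow-lumped : ∀ x S' → fromℕ (m C ∣ S' ∣) · inflow 𝔭 x S' ≡ fromℕ (m C x) · srwStep m x ∣ S' ∣
  inflow-lumped x S' with x ℕ.≟ 0 | x ℕ.≟ m
  ... | yes x≡0 | _       = inflow-lumped-absorbing S' (inj₁ x≡0)
  ... | no _    | yes x≡m = inflow-lumped-absorbing S' (inj₂ x≡m)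
  ... | no x≢0  | no x≢m with x ≤? m
  ...   | no x≰m = trans (cong (fromℕ (m C ∣ S' ∣) ·_) (inflow-beyond 𝔭 S' (ℕₚ.≰⇒> x≰m)))
                         (trans (ℚ.*-zeroʳ (fromℕ (m C ∣ S' ∣))) (sym ([mCx]·u≡0 _ (ℕₚ.≰⇒> x≰m))))
  ...   | yes x≤m = trans (cong (fromℕ (m C ∣ S' ∣) ·_) (inflow-interior 𝔭 S' x≢0 x≢m))
                          (interior-balance m x ∣ S' ∣ x≢0 (ℕₚ.≤∧≢⇒< x≤m x≢m) (gainSum-doubled S') (lossSum-doubled S'))

  inflow-uniform : ∀ x S' → inflow 𝔭 x S' ≡ inv (m C ∣ S' ∣) · (fromℕ (m C x) · srwStep m x ∣ S' ∣)
  inflow-uniform x S' = begin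
    inflow 𝔭 x S'
      ≡⟨ sym (ℚ.*-identityˡ _) ⟩
    1ℚ · inflow 𝔭 x S'
      ≡⟨ cong (_· inflow 𝔭 x S') (sym (inv*fromℕ (m C ∣ S' ∣) (C≢0 (∣p∣≤n S')))) ⟩
    (inv (m C ∣ S' ∣) · fromℕ (m C ∣ S' ∣)) · inflow 𝔭 x S'
      ≡⟨ ℚ.*-assoc (inv (m C ∣ S' ∣)) _ _ ⟩
    inv (m C ∣ S' ∣) · (fromℕ (m C ∣ S' ∣) · inflow 𝔭 x S')
      ≡⟨ cong (inv (m C ∣ S' ∣) ·_) (inflow-lumped x S') ⟩
    inv (m C ∣ S' ∣) · (fromℕ (m C x) · srwStep m x ∣ S' ∣) ∎

  extend-uniform : ∀ xs x c (ν : Subset m → ℚ) → (∀ S → ν S ≡ [ ∣ S ∣ ℕ.≟ x ] · c) →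
                   ΣS (extend 𝔭 ν xs) ≡ (c · fromℕ (m C x)) · srwPath m x xs
  extend-uniform [] x c ν ν-uniform = begin
    ΣS ν                                ≡⟨ Σ-cong (allSubsets m) ν-uniform ⟩
    ΣS {m} (λ S → [ ∣ S ∣ ℕ.≟ x ] · c)  ≡⟨ Σ-*ʳ (allSubsets m) (λ S → [ ∣ S ∣ ℕ.≟ x ]) c ⟩
    ΣS {m} (λ S → [ ∣ S ∣ ℕ.≟ x ]) · c  ≡⟨ cong (_· c) (ΣS-[∣∣≟] m x) ⟩
    fromℕ (m C x) · c                   ≡⟨ solve 2 (λ k c → k :* c := (c :* k) :* con 1ℚ) refl (fromℕ (m C x)) c ⟩
    (c · fromℕ (m C x)) · 1ℚ            ∎
  extend-uniform (y ∷ ys) x c ν ν-uniform with y ≤? m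
  ... | yes y≤m = trans (extend-uniform ys y c′ _ ν′-uniform) rescale
    where
    c′ : ℚ
    c′ = c · (inv (m C y) · (fromℕ (m C x) · srwStep m x y))
    ν′-uniform : ∀ S' → [ ∣ S' ∣ ℕ.≟ y ] · ΣS (λ S → ν S · transition 𝔭 S S') ≡ [ ∣ S' ∣ ℕ.≟ y ] · c′
    ν′-uniform S' = []-*-cong (∣ S' ∣ ℕ.≟ y) λ ∣S'∣≡y →
      trans (ΣS-uniform·transition 𝔭 ν ν-uniform S') (cong (c ·_) (trans (inflow-uniform x S')
        (cong (λ k → inv (m C k) · (fromℕ (m C x) · srwStep m x k)) ∣S'∣≡y)))
    rescale : (c′ · fromℕ (m C y)) · srwPath m y ys ≡ (c · fromℕ (m C x)) · (srwStep m x y · srwPath m y ys)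
    rescale = begin
      (c′ · fromℕ (m C y)) · srwPath m y ys
        ≡⟨ solve 6 (λ c i k s j P → ((c :* (i :* (k :* s))) :* j) :* P := ((c :* k) :* (s :* P)) :* (i :* j)) refl
             c (inv (m C y)) (fromℕ (m C x)) (srwStep m x y) (fromℕ (m C y)) (srwPath m y ys) ⟩
      ((c · fromℕ (m C x)) · (srwStep m x y · srwPath m y ys)) · (inv (m C y) · fromℕ (m C y))
        ≡⟨ trans (cong (((c · fromℕ (m C x)) · (srwStep m x y · srwPath m y ys)) ·_) (inv*fromℕ (m C y) (C≢0 y≤m)))
                 (ℚ.*-identityʳ _) ⟩
      (c · fromℕ (m C x)) · (srwStep m x y · srwPath m y ys) ∎
  ... | no y≰m = trans (extend-uniform ys y 0ℚ _ ν′-vanishes) vanish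
    where
    ν′-vanishes : ∀ S' → [ ∣ S' ∣ ℕ.≟ y ] · ΣS (λ S → ν S · transition 𝔭 S S') ≡ [ ∣ S' ∣ ℕ.≟ y ] · 0ℚ
    ν′-vanishes S' = []-*-cong (∣ S' ∣ ℕ.≟ y) (λ ∣S'∣≡y → ⊥-elim (y≰m (subst (_≤ m) ∣S'∣≡y (∣p∣≤n S'))))
    vanish : (0ℚ · fromℕ (m C y)) · srwPath m y ys ≡ (c · fromℕ (m C x)) · (srwStep m x y · srwPath m y ys)
    vanish = begin
      (0ℚ · fromℕ (m C y)) · srwPath m y ys
        ≡⟨ solve 2 (λ k P → (con 0ℚ :* k) :* P := con 0ℚ) refl (fromℕ (m C y)) (srwPath m y ys) ⟩
      0ℚ
        ≡⟨ sym (ℚ.*-zeroˡ (c · srwPath m y ys)) ⟩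
      0ℚ · (c · srwPath m y ys)
        ≡⟨ cong (_· (c · srwPath m y ys)) (sym (C*srwStep-beyond m x (ℕₚ.≰⇒> y≰m))) ⟩
      (fromℕ (m C x) · srwStep m x y) · (c · srwPath m y ys)
        ≡⟨ solve 4 (λ k s c P → (k :* s) :* (c :* P) := (c :* k) :* (s :* P)) refl
             (fromℕ (m C x)) (srwStep m x y) c (srwPath m y ys) ⟩
      (c · fromℕ (m C x)) · (srwStep m x y · srwPath m y ys) ∎

initialLaw-uniform : ∀ {m} A0 x0 (S : Subset m) →
  initialLaw A0 S · [ ∣ S ∣ ℕ.≟ x0 ] ≡ [ ∣ S ∣ ℕ.≟ x0 ] · ([ x0 ℕ.≟ A0 ] · inv (m C A0))
initialLaw-uniform {m} A0 x0 S = trans (ℚ.*-comm (initialLaw A0 S) [ ∣ S ∣ ℕ.≟ x0 ])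
  ([]-*-cong (∣ S ∣ ℕ.≟ x0) λ ∣S∣≡x0 →
    cong (_· inv (m C A0)) ([]-cong (∣ S ∣ ℕ.≟ A0) (x0 ℕ.≟ A0) (trans (sym ∣S∣≡x0)) (trans ∣S∣≡x0)))

initialLaw-normalised : ∀ {m A0} x0 → A0 ≤ m → ([ x0 ℕ.≟ A0 ] · inv (m C A0)) · fromℕ (m C x0) ≡ [ x0 ℕ.≟ A0 ]
initialLaw-normalised {m} {A0} x0 A0≤m = trans (ℚ.*-assoc [ x0 ℕ.≟ A0 ] (inv (m C A0)) (fromℕ (m C x0)))
  (trans ([]-*-cong (x0 ℕ.≟ A0) λ x0≡A0 →
           trans (cong (λ k → inv (m C A0) · fromℕ (m C k)) x0≡A0) (inv*fromℕ (m C A0) (C≢0 A0≤m)))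
         (ℚ.*-identityʳ [ x0 ℕ.≟ A0 ]))

theorem2p1 : (n : ℕ) → 1 ≤ n → (rank : Fin (2 * n) → Fin (2 * n)) →
    (𝔭 : WinningRule (2 * n)) → Symmetric 𝔭 →
    (A0 : ℕ) → A0 ≤ 2 * n →
    (x0 : ℕ) (xs : List ℕ) →
    warCountPathProb 𝔭 A0 x0 xs ≡ srwPathProb (2 * n) A0 x0 xs
theorem2p1 n _ _ 𝔭 𝔭-symmetric A0 A0≤2n x0 xs = begin
  warCountPathProb 𝔭 A0 x0 xs
    ≡⟨ extend-uniform 𝔭 𝔭-symmetric xs x0 ([ x0 ℕ.≟ A0 ] · inv (2 * n C A0)) _ (initialLaw-uniform A0 x0) ⟩
  (([ x0 ℕ.≟ A0 ] · inv (2 * n C A0)) · fromℕ (2 * n C x0)) · srwPath (2 * n) x0 xs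
    ≡⟨ cong (_· srwPath (2 * n) x0 xs) (initialLaw-normalised x0 A0≤2n) ⟩
  srwPathProb (2 * n) A0 x0 xs ∎
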